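{- Let $n \geq 4$ and let $C_1, C_2$ be a two-disjoint-cycle-cover of $S_n^2$. Then there exist vertices $a_1a_2\cdots a_n \in V(C_1)$ and $b_1b_2\cdots b_n \in V(C_2)$ such that $a_1, a_2, b_1, b_2$ are pairwise distinct.
   Context: For $n \geq 3$, the split-star network $S_n^2$ is the graph whose vertex set is the set of all permutations of $[n]$, written as strings $x_1x_2\cdots x_n$. Two distinct vertices $u = x_1\cdots x_n$ and $v = y_1\cdots y_n$ are adjacent iff one of the following holds: (i) $y_1 = x_2$, $y_2 = x_1$, $y_j = x_j$ for all $j \in [3,n]$; (ii) for some $i \in [3,n]$: $y_1 = x_2$, $y_2 = x_i$, $y_i = x_1$, $y_j = x_j$ for $j \in [3,n]\setminus\{i\}$; (iii) for some $i \in [3,n]$: $y_1 = x_i$, $y_2 = x_1$, $y_i = x_2$, $y_j = x_j$ for $j \in [3,n]\setminus\{i\}$. A two-disjoint-cycle-cover of a graph $G$ is a pair of vertex-disjoint cycles $C_1, C_2$ in $G$ with $V(C_1)\cup V(C_2) = V(G)$. -}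

module Defs where

open import Data.Nat using (ℕ; suc; _≤_; _+_)
open import Data.Fin using (Fin)
open import Data.Vec using (Vec; _∷_; lookup; _[_]≔_)
open import Data.List using (List; []; _∷_; length; _∷ʳ_)
open import Data.List.Membership.Propositional using (_∈_)
open import Data.List.Relation.Unary.All using (All)
open import Data.List.Relation.Unary.Unique.Propositional using (Unique)
open import Data.List.Relation.Unary.Linked using (Linked)
open import Data.Product using (Σ; ∃; _×_)
open import Data.Sum using (_⊎_)
open import Data.Empty using (⊥)
open import Relation.Nullary using (¬_)
open import Relation.Binary.PropositionalEquality using (_≡_; _≢_)

-- A string x₁x₂⋯xₙ over [n] is a vector of length n with entries in Fin n
-- (Fin n plays the role of [n]).
Word : ℕ → Set
Word n = Vec (Fin n) n

-- A word is a permutation of [n] iff its entries are pairwise distinct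
-- (injective map Fin n → Fin n).
IsPerm : ∀ {n} → Word n → Set
IsPerm {n} v = ∀ (i j : Fin n) → lookup v i ≡ lookup v j → i ≡ j

-- Generators of the split-star network on strings of length 2 + k.
-- A string x₁ x₂ xs (xs = x₃⋯xₙ); position j ∈ [3,n] corresponds to
-- index i : Fin k of xs.
data SSGen {A : Set} {k : ℕ} : Vec A (suc (suc k)) → Vec A (suc (suc k)) → Set where
  gen1 : ∀ x₁ x₂ xs → SSGen (x₁ ∷ x₂ ∷ xs) (x₂ ∷ x₁ ∷ xs)
  gen2 : ∀ x₁ x₂ xs (i : Fin k) →
         SSGen (x₁ ∷ x₂ ∷ xs) (x₂ ∷ lookup xs i ∷ (xs [ i ]≔ x₁))
  gen3 : ∀ x₁ x₂ xs (i : Fin k) →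
         SSGen (x₁ ∷ x₂ ∷ xs) (lookup xs i ∷ x₁ ∷ (xs [ i ]≔ x₂))

Adj : ∀ {k} → Word (suc (suc k)) → Word (suc (suc k)) → Set
Adj u v = u ≢ v × SSGen u v

IsCycle : ∀ {k} → List (Word (suc (suc k))) → Set
IsCycle [] = ⊥
IsCycle {k} (v ∷ vs) =
  3 ≤ length (v ∷ vs) ×
  All IsPerm (v ∷ vs) ×
  Unique (v ∷ vs) ×
  Linked Adj ((v ∷ vs) ∷ʳ v)

TwoDisjointCycleCover : ∀ {k} → List (Word (suc (suc k))) → List (Word (suc (suc k))) → Set
TwoDisjointCycleCover {k} C₁ C₂ =
  IsCycle C₁ × IsCycle C₂ ×
  (∀ v → v ∈ C₁ → ¬ (v ∈ C₂)) ×
  (∀ (v : Word (suc (suc k))) → IsPerm v → v ∈ C₁ ⊎ v ∈ C₂)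

{-# OPTIONS --safe #-}
-- Call {x₁, x₂} the front pair of a vertex x₁x₂⋯xₙ, and let the front graph of a
-- cycle be the graph on [n] whose edges are the front pairs of its vertices.
-- Every pair of distinct symbols is the front pair of some permutation, so the
-- front graphs of C₁ and C₂ together cover the complete graph on [n]. A cycle
-- cannot use two generators of type (i) in a row, so one of its first two edges
-- is of type (ii) or (iii), and such an edge x₁x₂⋯ — x₂xᵢ⋯ (or xᵢx₁⋯) yields a
-- path with two edges in the front graph. A short case analysis shows that two
-- graphs covering Kₙ (n ≥ 4) that both contain such a path have disjoint edges.
module Submission where

open import Level using (Level; _⊔_; 0ℓ)
open import Data.Nat using (ℕ; suc; _≤_; s≤s; z≤n)
open import Data.Fin using (Fin; zero; suc; punchIn; punchOut)
open import Data.Fin.Properties as Fin using (punchInᵢ≢i; punchIn-injective; punchIn-punchOut)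
open import Data.Fin.Permutation.Components using (transpose; transpose-inverse)
open import Data.Vec using (_∷_; lookup; tabulate)
open import Data.Vec.Properties using (lookup∘tabulate)
open import Data.List using (List; []; _∷_)
open import Data.List.Membership.Propositional using (_∈_)
open import Data.List.Relation.Unary.Any using (here; there)
open import Data.List.Relation.Unary.All using (_∷_)
open import Data.List.Relation.Unary.AllPairs using (_∷_)
open import Data.List.Relation.Unary.Linked using (_∷_)
open import Data.Product using (∃; Σ; _×_; _,_)
open import Data.Sum using (_⊎_; inj₁; inj₂)
open import Data.Empty using (⊥-elim)
open import Function using (_∘_; Injective)
open import Relation.Nullary using (yes; no)
open import Relation.Nullary.Decidable using (dec-true; dec-false)
open import Relation.Binary.Core using (Rel)
open import Relation.Binary.Definitions using (DecidableEquality; Symmetric)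
open import Relation.Binary.Construct.Closure.Symmetric using (SymClosure; fwd; bwd; symmetric)
open import Relation.Binary.PropositionalEquality using (_≡_; _≢_; refl; sym; trans; cong; ≢-sym)

open import Defs

private
  variable
    a ℓ ℓ₁ ℓ₂ : Level
    A : Set a

Distinct4 : {A : Set a} → A → A → A → A → Set a
Distinct4 p q r s = p ≢ q × p ≢ r × p ≢ s × q ≢ r × q ≢ s × r ≢ s

distinct4-swapˡ : {p q r s : A} → Distinct4 p q r s → Distinct4 q p r s
distinct4-swapˡ (p≢q , p≢r , p≢s , q≢r , q≢s , r≢s) = ≢-sym p≢q , q≢r , q≢s , p≢r , p≢s , r≢s

distinct4-swapʳ : {p q r s : A} → Distinct4 p q r s → Distinct4 p q s r
distinct4-swapʳ (p≢q , p≢r , p≢s , q≢r , q≢s , r≢s) = p≢q , p≢s , p≢r , q≢s , q≢r , ≢-sym r≢s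

record TwoPath {A : Set a} (E : Rel A ℓ) : Set (a ⊔ ℓ) where
  constructor twoPath
  field
    {x y z} : A
    x≢y : x ≢ y
    y≢z : y ≢ z
    x≢z : x ≢ z
    xy : E x y
    yz : E y z

Avoids : {A : Set a} {E : Rel A ℓ} → A → TwoPath E → Set a
Avoids t P = x ≢ t × y ≢ t × z ≢ t
  where open TwoPath P

record FourCycle {A : Set a} (E : Rel A ℓ) : Set (a ⊔ ℓ) where
  constructor fourCycle
  field
    {p q r s} : A
    distinct : Distinct4 p q r s
    pq : E p q
    qr : E q r
    rs : E r s
    sp : E s p

record DisjointEdges {A : Set a} (E₁ : Rel A ℓ₁) (E₂ : Rel A ℓ₂) : Set (a ⊔ ℓ₁ ⊔ ℓ₂) where
  constructor disjointEdges
  field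
    {p q r s} : A
    edge₁ : E₁ p q
    edge₂ : E₂ r s
    distinct : Distinct4 p q r s

symClosure-disjointEdges : {R₁ : Rel A ℓ₁} {R₂ : Rel A ℓ₂} →
  DisjointEdges (SymClosure R₁) (SymClosure R₂) → DisjointEdges R₁ R₂
symClosure-disjointEdges (disjointEdges (fwd e₁) (fwd e₂) d) = disjointEdges e₁ e₂ d
symClosure-disjointEdges (disjointEdges (fwd e₁) (bwd e₂) d) =
  disjointEdges e₁ e₂ (distinct4-swapʳ d)
symClosure-disjointEdges (disjointEdges (bwd e₁) (fwd e₂) d) =
  disjointEdges e₁ e₂ (distinct4-swapˡ d)
symClosure-disjointEdges (disjointEdges (bwd e₁) (bwd e₂) d) =
  disjointEdges e₁ e₂ (distinct4-swapʳ (distinct4-swapˡ d))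

module _ {E₁ : Rel A ℓ₁} {E₂ : Rel A ℓ₂} where

  twoPath-fourCycle-or-disjoint : (∀ {u v} → u ≢ v → E₁ u v ⊎ E₂ u v) →
    (P : TwoPath E₁) → ∀ {t} → Avoids t P → FourCycle E₁ ⊎ DisjointEdges E₁ E₂
  twoPath-fourCycle-or-disjoint cover (twoPath x≢y y≢z x≢z xy yz) (x≢t , y≢t , z≢t)
    with cover z≢t
  ... | inj₂ zt = inj₂ (disjointEdges xy zt (x≢y , x≢z , x≢t , y≢z , y≢t , z≢t))
  ... | inj₁ zt with cover (≢-sym x≢t)
  ...   | inj₂ tx = inj₂ (disjointEdges yz tx (y≢z , y≢t , ≢-sym x≢y , z≢t , ≢-sym x≢z , ≢-sym x≢t))
  ...   | inj₁ tx = inj₁ (fourCycle (x≢y , x≢z , x≢t , y≢z , y≢t , z≢t) xy yz zt tx)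

module _ (_≟_ : DecidableEquality A) {E₁ : Rel A ℓ₁} {E₂ : Rel A ℓ₂} where

  twoPath-edge-disjoint : (P : TwoPath E₁) → ∀ {s t} → E₂ s t → s ≢ t → Avoids t P →
    s ≢ TwoPath.y P → DisjointEdges E₁ E₂
  twoPath-edge-disjoint (twoPath {x} x≢y y≢z x≢z xy yz) {s} st s≢t (x≢t , y≢t , z≢t) s≢y
    with s ≟ x
  ... | yes refl = disjointEdges yz st (y≢z , ≢-sym x≢y , y≢t , ≢-sym x≢z , z≢t , s≢t)
  ... | no s≢x = disjointEdges xy st (x≢y , ≢-sym s≢x , x≢t , ≢-sym s≢y , y≢t , s≢t)

  fourCycle-twoPath-avoiding : FourCycle E₁ → ∀ t → Σ (TwoPath E₁) (Avoids t)
  fourCycle-twoPath-avoiding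
    (fourCycle {p} {q} {r} (p≢q , p≢r , p≢s , q≢r , q≢s , r≢s) pq qr rs sp) t
    with t ≟ p | t ≟ q | t ≟ r
  ... | yes refl | _ | _ = twoPath q≢r r≢s q≢s qr rs , ≢-sym p≢q , ≢-sym p≢r , ≢-sym p≢s
  ... | no _ | yes refl | _ = twoPath r≢s (≢-sym p≢s) (≢-sym p≢r) rs sp , ≢-sym q≢r , ≢-sym q≢s , p≢q
  ... | no _ | no _ | yes refl = twoPath (≢-sym p≢s) p≢q (≢-sym q≢s) sp pq , ≢-sym r≢s , p≢r , q≢r
  ... | no t≢p | no t≢q | no t≢r = twoPath p≢q q≢r p≢r pq qr , ≢-sym t≢p , ≢-sym t≢q , ≢-sym t≢r

  -- The four-cycle case: pick a two-path of the four-cycle avoiding the middle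
  -- vertex of the E₂-path; one of the two E₂-edges then misses one of its edges.
  disjointEdges-of-covering-twoPaths : (∀ {u v} → u ≢ v → E₁ u v ⊎ E₂ u v) → Symmetric E₂ →
    (∀ u v w → ∃ λ t → u ≢ t × v ≢ t × w ≢ t) →
    TwoPath E₁ → TwoPath E₂ → DisjointEdges E₁ E₂
  disjointEdges-of-covering-twoPaths cover sym₂ fresh P₁ P₂
    with fresh (TwoPath.x P₁) (TwoPath.y P₁) (TwoPath.z P₁)
  ... | t , P₁-avoids-t with twoPath-fourCycle-or-disjoint cover P₁ P₁-avoids-t
  ... | inj₂ disjoint = disjoint
  ... | inj₁ Q with fourCycle-twoPath-avoiding Q (TwoPath.y P₂)
  ... | P , P-avoids with TwoPath.x P₂ ≟ TwoPath.y P
  ... | no x₂≢y = twoPath-edge-disjoint P (TwoPath.xy P₂) (TwoPath.x≢y P₂) P-avoids x₂≢y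
  ... | yes x₂≡y =
    twoPath-edge-disjoint P (sym₂ (TwoPath.yz P₂)) (≢-sym (TwoPath.y≢z P₂)) P-avoids
      (λ z₂≡y → TwoPath.x≢z P₂ (trans x₂≡y (sym z₂≡y)))

punchIn-preimage-unique : ∀ {n} (u v : Fin (suc (suc n))) →
  ∃ λ v′ → ∀ {w} → punchIn u w ≡ v → w ≡ v′
punchIn-preimage-unique u v with u Fin.≟ v
... | yes refl = zero , λ {w} e → ⊥-elim (punchInᵢ≢i u w e)
... | no u≢v = punchOut u≢v , λ e → punchIn-injective u _ _ (trans e (sym (punchIn-punchOut u≢v)))

fresh₃ : ∀ {m} (u v w : Fin (suc (suc (suc (suc m))))) → ∃ λ t → u ≢ t × v ≢ t × w ≢ t
fresh₃ u v w with punchIn-preimage-unique u v | punchIn-preimage-unique u w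
... | v′ , v-fibre | w′ , w-fibre with punchIn-preimage-unique v′ w′
... | w″ , w′-fibre =
  punchIn u (punchIn v′ (punchIn w″ zero)) ,
  ≢-sym (punchInᵢ≢i u _) ,
  (λ e → punchInᵢ≢i v′ _ (v-fibre (sym e))) ,
  (λ e → punchInᵢ≢i w″ zero (w′-fibre (w-fibre (sym e))))

module _ {n : ℕ} where

  transpose-matchˡ : (i j : Fin n) → transpose i j i ≡ j
  transpose-matchˡ i j rewrite dec-true (i Fin.≟ i) refl = refl

  transpose-fixes : {i j k : Fin n} → k ≢ i → k ≢ j → transpose i j k ≡ k
  transpose-fixes {i} {j} {k} k≢i k≢j
    rewrite dec-false (k Fin.≟ i) k≢i | dec-false (k Fin.≟ j) k≢j = refl

  transpose-injective : (i j : Fin n) → Injective _≡_ _≡_ (transpose i j)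
  transpose-injective i j e =
    trans (sym (transpose-inverse j i)) (trans (cong (transpose j i) e) (transpose-inverse j i))

  ∃-permutation-mapping : {i j p q : Fin n} → i ≢ j → p ≢ q →
    ∃ λ (σ : Fin n → Fin n) → Injective _≡_ _≡_ σ × σ i ≡ p × σ j ≡ q
  ∃-permutation-mapping {i} {j} {p} {q} i≢j p≢q =
    σ , transpose-injective j q′ ∘ transpose-injective i p ,
    trans (cong (transpose i p) (transpose-fixes i≢j i≢q′)) (transpose-matchˡ i p) ,
    trans (cong (transpose i p) (transpose-matchˡ j q′)) (transpose-inverse i p)
    where
    q′ = transpose p i q
    σ = transpose i p ∘ transpose j q′
    i≢q′ : i ≢ q′
    i≢q′ e = p≢q (trans (sym (transpose-matchˡ i p))
                        (trans (cong (transpose i p) e) (transpose-inverse i p)))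

module _ {k : ℕ} where

  PrefixIn : List (Word (suc (suc k))) → Rel (Fin (suc (suc k))) 0ℓ
  PrefixIn C p q = ∃ λ w → w ∈ C × lookup w zero ≡ p × lookup w (suc zero) ≡ q

  FrontGraph : List (Word (suc (suc k))) → Rel (Fin (suc (suc k))) 0ℓ
  FrontGraph C = SymClosure (PrefixIn C)

  ∃-perm-with-prefix : {p q : Fin (suc (suc k))} → p ≢ q →
    ∃ λ (w : Word (suc (suc k))) → IsPerm w × lookup w zero ≡ p × lookup w (suc zero) ≡ q
  ∃-perm-with-prefix p≢q with ∃-permutation-mapping (λ ()) p≢q
  ... | σ , σ-injective , σ₀ , σ₁ = tabulate σ , tabulate-perm , σ₀ , σ₁
    where
    tabulate-perm : IsPerm (tabulate σ)
    tabulate-perm i j e =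
      σ-injective (trans (sym (lookup∘tabulate σ i)) (trans e (lookup∘tabulate σ j)))

  frontGraphs-cover : {C₁ C₂ : List (Word (suc (suc k)))} →
    (∀ w → IsPerm w → w ∈ C₁ ⊎ w ∈ C₂) →
    ∀ {p q} → p ≢ q → FrontGraph C₁ p q ⊎ FrontGraph C₂ p q
  frontGraphs-cover cover p≢q with ∃-perm-with-prefix p≢q
  ... | w , w-perm , w₀ , w₁ with cover w w-perm
  ... | inj₁ w∈C₁ = inj₁ (fwd (w , w∈C₁ , w₀ , w₁))
  ... | inj₂ w∈C₂ = inj₂ (fwd (w , w∈C₂ , w₀ , w₁))

  swap₁₂ : Word (suc (suc k)) → Word (suc (suc k))
  swap₁₂ (x₁ ∷ x₂ ∷ xs) = x₂ ∷ x₁ ∷ xs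

  swap₁₂-involutive : (w : Word (suc (suc k))) → swap₁₂ (swap₁₂ w) ≡ w
  swap₁₂-involutive (x₁ ∷ x₂ ∷ xs) = refl

  perm-entries-distinct : {w : Word (suc (suc k))} → IsPerm w →
    ∀ i j → i ≢ j → lookup w i ≢ lookup w j
  perm-entries-distinct w-perm i j i≢j = i≢j ∘ w-perm i j

  generator-twoPath : {C : List (Word (suc (suc k)))} {u v : Word (suc (suc k))} →
    IsPerm u → u ∈ C → v ∈ C → SSGen u v → TwoPath (FrontGraph C) ⊎ v ≡ swap₁₂ u
  generator-twoPath u-perm u∈C v∈C (gen1 x₁ x₂ xs) = inj₂ refl
  generator-twoPath u-perm u∈C v∈C (gen2 x₁ x₂ xs i) = inj₁ (twoPath
    (distinct zero (suc zero) (λ ())) (distinct (suc zero) (suc (suc i)) (λ ()))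
    (distinct zero (suc (suc i)) (λ ()))
    (fwd (_ , u∈C , refl , refl)) (fwd (_ , v∈C , refl , refl)))
    where distinct = perm-entries-distinct {w = x₁ ∷ x₂ ∷ xs} u-perm
  generator-twoPath u-perm u∈C v∈C (gen3 x₁ x₂ xs i) = inj₁ (twoPath
    (distinct (suc zero) zero (λ ())) (distinct zero (suc (suc i)) (λ ()))
    (distinct (suc zero) (suc (suc i)) (λ ()))
    (bwd (_ , u∈C , refl , refl)) (bwd (_ , v∈C , refl , refl)))
    where distinct = perm-entries-distinct {w = x₁ ∷ x₂ ∷ xs} u-perm

  cycle-twoPath : {C : List (Word (suc (suc k)))} → IsCycle C → TwoPath (FrontGraph C)
  cycle-twoPath {[]} ()
  cycle-twoPath {_ ∷ []} (s≤s () , _)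
  cycle-twoPath {_ ∷ _ ∷ []} (s≤s (s≤s ()) , _)
  cycle-twoPath {v₀ ∷ v₁ ∷ v₂ ∷ _}
    (_ , (v₀-perm ∷ v₁-perm ∷ _) , ((_ ∷ v₀≢v₂ ∷ _) ∷ _) , ((_ , g₀₁) ∷ (_ , g₁₂) ∷ _))
    with generator-twoPath v₀-perm (here refl) (there (here refl)) g₀₁
  ... | inj₁ P = P
  ... | inj₂ refl with generator-twoPath v₁-perm (there (here refl)) (there (there (here refl))) g₁₂
  ... | inj₁ P = P
  ... | inj₂ refl = ⊥-elim (v₀≢v₂ (sym (swap₁₂-involutive v₀)))

lemma2p12 : (k : ℕ) → 2 ≤ k →
    (C₁ C₂ : List (Word (suc (suc k)))) → TwoDisjointCycleCover C₁ C₂ →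
    Σ (Word (suc (suc k))) λ a → Σ (Word (suc (suc k))) λ b →
      a ∈ C₁ × b ∈ C₂ ×
      lookup a zero ≢ lookup a (Fin.suc zero) ×
      lookup a zero ≢ lookup b zero ×
      lookup a zero ≢ lookup b (Fin.suc zero) ×
      lookup a (Fin.suc zero) ≢ lookup b zero ×
      lookup a (Fin.suc zero) ≢ lookup b (Fin.suc zero) ×
      lookup b zero ≢ lookup b (Fin.suc zero)
lemma2p12 (suc (suc m)) (s≤s (s≤s z≤n)) C₁ C₂ (C₁-cycle , C₂-cycle , _ , cover)
  with symClosure-disjointEdges
         (disjointEdges-of-covering-twoPaths Fin._≟_ (frontGraphs-cover cover)
           (symmetric (PrefixIn C₂)) fresh₃
           (cycle-twoPath C₁-cycle) (cycle-twoPath C₂-cycle))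
... | disjointEdges (a , a∈C₁ , refl , refl) (b , b∈C₂ , refl , refl) distinct =
  a , b , a∈C₁ , b∈C₂ , distinct
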